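{- Let $k\ge1$. (1) There is no proper coloring of $\mathbb{Z}_2^k\setminus\{0\}$ by $k-1$ colors. (2) There exists a proper coloring of $\mathbb{Z}_2^k\setminus\{0\}$ by $k$ colors.
   Context: A set $\{a_1,\ldots,a_n\}\subseteq\mathbb{Z}_2^k$ is a minimal linear dependence if $a_1+\cdots+a_n=0$ and every proper subset is linearly independent. A coloring $\rho\colon\mathbb{Z}_2^k\setminus\{0\}\to C$ is proper if no minimal linear dependence $A=\{a_1,\ldots,a_{2r+1}\}\subseteq\mathbb{Z}_2^k\setminus\{0\}$ with an odd number of elements is single-colored, i.e. $|\rho(A)|\neq1$ for every such $A$. A coloring by $c$ colors means $|C|=c$. -}

module Defs where

open import Data.Bool using (Bool; true; false; _xor_)
open import Data.Nat using (ℕ; zero; suc; _+_; _*_)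
open import Data.Fin using (Fin; zero; suc)
open import Data.Fin.Subset using (Subset; _⊆_; _⊂_; Nonempty; ⊤; inside; outside)
open import Data.Vec using (Vec; []; _∷_; replicate; zipWith; lookup)
open import Data.Product using (Σ; _×_; ∃)
open import Relation.Nullary using (¬_)
open import Relation.Binary.PropositionalEquality using (_≡_; _≢_)
open import Function.Definitions using (Injective)

Z2^ : ℕ → Set
Z2^ k = Vec Bool k

𝟎 : ∀ {k} → Z2^ k
𝟎 = replicate _ false

_⊕_ : ∀ {k} → Z2^ k → Z2^ k → Z2^ k
_⊕_ = zipWith _xor_

sumOver : ∀ {k n} → (Fin n → Z2^ k) → Subset n → Z2^ k
sumOver {n = zero}  a []          = 𝟎
sumOver {n = suc n} a (true ∷ S)  = a zero ⊕ sumOver (λ i → a (suc i)) S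
sumOver {n = suc n} a (false ∷ S) = sumOver (λ i → a (suc i)) S

-- The sub-family of a given by the subset S is linearly independent over Z_2:
-- no nonempty subfamily sums to 0 (the only scalars are 0 and 1).
LinIndepOn : ∀ {k n} → (Fin n → Z2^ k) → Subset n → Set
LinIndepOn a S = ∀ T → T ⊆ S → Nonempty T → sumOver a T ≢ 𝟎

-- A set {a_1,...,a_n} (given by an injective indexing a) is a minimal
-- linear dependence: total sum is 0 and every proper subset is independent.
MinimalLinDep : ∀ {k n} → (Fin n → Z2^ k) → Set
MinimalLinDep {n = n} a =
  Injective _≡_ _≡_ a × sumOver a ⊤ ≡ 𝟎 × (∀ S → S ⊂ ⊤ → LinIndepOn a S)

Coloring : ℕ → ℕ → Set
Coloring k c = (v : Z2^ k) → v ≢ 𝟎 → Fin c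

Proper : ∀ {k c} → Coloring k c → Set
Proper {k} ρ =
  ∀ (r : ℕ) (a : Fin (suc (2 * r)) → Z2^ k) (nz : ∀ i → a i ≢ 𝟎) →
    MinimalLinDep a →
    ¬ (Σ _ λ col → ∀ i → ρ (a i) (nz i) ≡ col)

-- Part (2): colour v by the position of its first 1. An odd number of vectors sharing that
-- position sum to a vector which is 1 there, so no monochromatic odd family sums to 𝟎.
--
-- Part (1): by linear duality over ℤ₂, applied to {(1, x) | x ∈ X}, a set X either contains an
-- odd family summing to 𝟎 or lies in an affine hyperplane f · x = 1. If each of the c < k colour
-- classes avoided odd zero sums, the nonzero vectors of ker f₁ ∩ … ∩ ker f_c, a subspace of
-- dimension at least k − c ≥ 1, would get no colour. So some class has an odd zero-sum family;
-- replacing it by a proper zero-sum part or by the complement of one, whichever is odd, until no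
-- proper part sums to 𝟎, gives a monochromatic odd minimal linear dependence.
module Submission where

open import Defs
open import Data.Bool using (Bool; true; false; not; _∧_; _xor_)
open import Data.Bool.Properties
  using (xor-assoc; xor-comm; xor-same; xor-identityʳ; not-involutive; not-injective; not-distribˡ-xor;
         ∧-distribʳ-xor; ∧-identityʳ; xor-∧-commutativeRing)
  renaming (_≟_ to _≟ᵇ_)
open import Algebra.Bundles using (CommutativeRing)
open import Algebra.Properties.CommutativeSemigroup
  (CommutativeRing.+-commutativeSemigroup xor-∧-commutativeRing) using (interchange)
open import Data.Fin using (Fin; zero; suc) renaming (_≟_ to _≟ᶠ_)
open import Data.Fin.Subset using (Subset; _⊂_; Nonempty; ⊤; ∁; ∣_∣; ⁅_⁆; _∪_) renaming (⊥ to ∅)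
open import Data.Fin.Subset.Properties
  using (anySubset?; nonempty?; _⊂?_; ⊆⊤; ∈⊤; ⊆-⊂-trans; p⊂q⇒∣p∣<∣q∣; ∣⊤∣≡n; ∣p∣≤n; ∣∁p∣≡n∸∣p∣;
         x∈p⇒x∉∁p; x∈⁅x⁆; x∈⁅y⁆⇒x≡y; x∈p∪q⁺; x∈p∪q⁻; ∪-identityˡ; ∪-identityʳ)
open import Data.List using (List; []; _∷_; length; map)
import Data.List as List
open import Data.List.Properties using (length-map)
open import Data.List.Membership.Propositional.Properties using (∈-lookup)
open import Data.List.Relation.Unary.All as All using (All; []; _∷_)
open import Data.List.Relation.Unary.All.Properties using (map⁺)
open import Data.Maybe using (Maybe; just; nothing)
open import Data.Maybe.Properties using (just-injective) renaming (≡-dec to ≡-decᵐ)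
open import Data.Nat using (ℕ; zero; suc; _+_; _*_; _∸_; _<_; _≥_; s≤s)
open import Data.Nat.Induction using (<-wellFounded)
open import Data.Nat.Properties using (≤-refl; *-suc; +-identityʳ; m+[n∸m]≡n)
import Data.Product as Product
open import Data.Product using (Σ; ∃; ∃₂; _×_; _,_; proj₁; proj₂)
open import Data.Sum using (_⊎_; inj₁; inj₂; [_,_]′)
open import Data.Vec using ([]; _∷_; lookup)
open import Data.Vec.Properties
  using (zipWith-assoc; zipWith-comm; zipWith-identityˡ; zipWith-identityʳ; lookup-zipWith;
         lookup-replicate; ∷-injective; ∷-injectiveˡ; ∷-injectiveʳ)
  renaming (≡-dec to ≡-decᵛ)
open import Function using (_∘_; id)
open import Function.Definitions using (Injective)
open import Induction.WellFounded using (Acc; acc)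
open import Level using (Level)
open import Relation.Nullary using (¬_; Dec; yes; no; contradiction)
open import Relation.Nullary.Decidable using (_×-dec_; _⊎-dec_)
open import Relation.Unary using (Pred; Decidable)
open import Relation.Binary.PropositionalEquality
  using (_≡_; _≢_; refl; sym; trans; cong; cong₂; subst; module ≡-Reasoning)

private
  variable
    ℓ : Level
    c k m n : ℕ

infix 4 _≟_
_≟_ : (u v : Z2^ k) → Dec (u ≡ v)
_≟_ = ≡-decᵛ _≟ᵇ_

⊕-assoc : (x y z : Z2^ k) → (x ⊕ y) ⊕ z ≡ x ⊕ (y ⊕ z)
⊕-assoc = zipWith-assoc xor-assoc

⊕-comm : (x y : Z2^ k) → x ⊕ y ≡ y ⊕ x
⊕-comm = zipWith-comm xor-comm

⊕-identityˡ : (x : Z2^ k) → 𝟎 ⊕ x ≡ x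
⊕-identityˡ = zipWith-identityˡ λ _ → refl

⊕-identityʳ : (x : Z2^ k) → x ⊕ 𝟎 ≡ x
⊕-identityʳ = zipWith-identityʳ xor-identityʳ

⊕-self : (x : Z2^ k) → x ⊕ x ≡ 𝟎
⊕-self []      = refl
⊕-self (b ∷ x) = cong₂ _∷_ (xor-same b) (⊕-self x)

⊕-cancelˡ : (x y : Z2^ k) → x ⊕ (x ⊕ y) ≡ y
⊕-cancelˡ x y = begin
  x ⊕ (x ⊕ y) ≡⟨ sym (⊕-assoc x x y) ⟩
  (x ⊕ x) ⊕ y ≡⟨ cong (_⊕ y) (⊕-self x) ⟩
  𝟎 ⊕ y       ≡⟨ ⊕-identityˡ y ⟩
  y           ∎
  where open ≡-Reasoning

Additive : (Z2^ k → Z2^ m) → Set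
Additive φ = ∀ x y → φ (x ⊕ y) ≡ φ x ⊕ φ y

additive⇒𝟎 : {φ : Z2^ k → Z2^ m} → Additive φ → φ 𝟎 ≡ 𝟎
additive⇒𝟎 {φ = φ} φ-⊕ = begin
  φ 𝟎                ≡⟨ sym (⊕-cancelˡ (φ 𝟎) (φ 𝟎)) ⟩
  φ 𝟎 ⊕ (φ 𝟎 ⊕ φ 𝟎)  ≡⟨ cong (φ 𝟎 ⊕_) (sym (φ-⊕ 𝟎 𝟎)) ⟩
  φ 𝟎 ⊕ φ (𝟎 ⊕ 𝟎)    ≡⟨ cong (λ x → φ 𝟎 ⊕ φ x) (⊕-self 𝟎) ⟩
  φ 𝟎 ⊕ φ 𝟎          ≡⟨ ⊕-self (φ 𝟎) ⟩
  𝟎                  ∎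
  where open ≡-Reasoning

sum : List (Z2^ k) → Z2^ k
sum []      = 𝟎
sum (x ∷ L) = x ⊕ sum L

sum-map : {φ : Z2^ k → Z2^ m} → Additive φ → (L : List (Z2^ k)) → sum (map φ L) ≡ φ (sum L)
sum-map φ-⊕ []      = sym (additive⇒𝟎 φ-⊕)
sum-map φ-⊕ (x ∷ L) = trans (cong (_ ⊕_) (sum-map φ-⊕ L)) (sym (φ-⊕ x (sum L)))

sumOver-lookup : (L : List (Z2^ k)) → sumOver (List.lookup L) ⊤ ≡ sum L
sumOver-lookup []      = refl
sumOver-lookup (x ∷ L) = cong (x ⊕_) (sumOver-lookup L)

-- The bit of the vector comes first, so that f · (false ∷ x) reduces to the tail.
infix 7 _·_
_·_ : Z2^ k → Z2^ k → Bool
[]      · []      = false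
(a ∷ f) · (b ∷ x) = (b ∧ a) xor (f · x)

·-𝟎ʳ : (f : Z2^ k) → f · 𝟎 ≡ false
·-𝟎ʳ []      = refl
·-𝟎ʳ (a ∷ f) = ·-𝟎ʳ f

·-𝟎ˡ : (x : Z2^ k) → 𝟎 · x ≡ false
·-𝟎ˡ []          = refl
·-𝟎ˡ (false ∷ x) = ·-𝟎ˡ x
·-𝟎ˡ (true ∷ x)  = ·-𝟎ˡ x

·-distrib-⊕ : (f x y : Z2^ k) → f · (x ⊕ y) ≡ f · x xor f · y
·-distrib-⊕ []      []      []      = refl
·-distrib-⊕ (a ∷ f) (b ∷ x) (c ∷ y) = begin
  ((b xor c) ∧ a) xor f · (x ⊕ y)             ≡⟨ cong₂ _xor_ (∧-distribʳ-xor a b c) (·-distrib-⊕ f x y) ⟩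
  ((b ∧ a) xor (c ∧ a)) xor (f · x xor f · y) ≡⟨ interchange (b ∧ a) (c ∧ a) (f · x) (f · y) ⟩
  ((b ∧ a) xor f · x) xor ((c ∧ a) xor f · y) ∎
  where open ≡-Reasoning

Span : Pred (Z2^ k) ℓ → Pred (Z2^ k) ℓ
Span W u = ∃ λ L → All W L × sum L ≡ u

Span-𝟎 : {W : Pred (Z2^ k) ℓ} → Span W 𝟎
Span-𝟎 = [] , [] , refl

Span-∷ : {W : Pred (Z2^ k) ℓ} {w u : Z2^ k} → W w → Span W u → Span W (w ⊕ u)
Span-∷ {w = w} Ww (L , Ws , refl) = w ∷ L , Ww ∷ Ws , refl

Span-∈ : {W : Pred (Z2^ k) ℓ} {w : Z2^ k} → W w → Span W w
Span-∈ {w = w} Ww = subst (Span _) (⊕-identityʳ w) (Span-∷ Ww Span-𝟎)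

Span-⊕ : {W : Pred (Z2^ k) ℓ} {u v : Z2^ k} → Span W u → Span W v → Span W (u ⊕ v)
Span-⊕ {v = v} ([] , [] , refl)          Sv = subst (Span _) (sym (⊕-identityˡ v)) Sv
Span-⊕ {v = v} (x ∷ L , Wx ∷ Ws , refl) Sv =
  subst (Span _) (sym (⊕-assoc x (sum L) v)) (Span-∷ Wx (Span-⊕ (L , Ws , refl) Sv))

Span-map : {V : Pred (Z2^ k) ℓ} {W : Pred (Z2^ m) ℓ} {φ : Z2^ k → Z2^ m} → Additive φ →
           (∀ {x} → V x → Span W (φ x)) → ∀ {u} → Span V u → Span W (φ u)
Span-map {W = W} {φ = φ} φ-⊕ V⇒W (L , Vs , refl) = go L Vs
  where
  go : ∀ L → All _ L → Span W (φ (sum L))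
  go []      []       = subst (Span W) (sym (additive⇒𝟎 φ-⊕)) Span-𝟎
  go (x ∷ L) (Vx ∷ Vs) = subst (Span W) (sym (φ-⊕ x (sum L))) (Span-⊕ (V⇒W Vx) (go L Vs))

Separator : Pred (Z2^ k) ℓ → Z2^ k → Pred (Z2^ k) ℓ
Separator W u f = (∀ {w} → W w → f · w ≡ false) × f · u ≡ true

SpannedOrSeparated : Pred (Z2^ k) ℓ → Z2^ k → Set ℓ
SpannedOrSeparated W u = Span W u ⊎ ∃ (Separator W u)

spannedOrSeparated-shift : {W : Pred (Z2^ k) ℓ} {w u : Z2^ k} → W w →
                           SpannedOrSeparated W u → SpannedOrSeparated W (w ⊕ u)
spannedOrSeparated-shift Ww (inj₁ Su) = inj₁ (Span-∷ Ww Su)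
spannedOrSeparated-shift {w = w} {u} Ww (inj₂ (f , f⊥W , fu)) =
  inj₂ (f , f⊥W , trans (·-distrib-⊕ f w u) (cong₂ _xor_ (f⊥W Ww) fu))

spannedOrSeparated-tail : {W : Pred (Z2^ (suc k)) ℓ} → (∀ x → ¬ W (true ∷ x)) →
  ∀ b {y} → SpannedOrSeparated (W ∘ (false ∷_)) y → SpannedOrSeparated W (b ∷ y)
spannedOrSeparated-tail {W = W} ∄W₁ true {y} _ = inj₂ (true ∷ 𝟎 , 𝟎⊥W , cong not (·-𝟎ˡ y))
  where
  𝟎⊥W : ∀ {w} → W w → (true ∷ 𝟎) · w ≡ false
  𝟎⊥W {true ∷ x}  Ww = contradiction Ww (∄W₁ x)
  𝟎⊥W {false ∷ x} Ww = ·-𝟎ˡ x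
spannedOrSeparated-tail ∄W₁ false (inj₁ Sy) = inj₁ (Span-map (λ _ _ → refl) Span-∈ Sy)
spannedOrSeparated-tail {W = W} ∄W₁ false (inj₂ (g , g⊥W₀ , gy)) = inj₂ (false ∷ g , g⊥W , gy)
  where
  g⊥W : ∀ {w} → W w → (false ∷ g) · w ≡ false
  g⊥W {true ∷ x}  Ww = contradiction Ww (∄W₁ x)
  g⊥W {false ∷ x} Ww = g⊥W₀ Ww

-- The image of W in the quotient of Z2^(suc k) by the line through (true ∷ z),
-- the quotient being identified with Z2^k via x ↦ false ∷ x.
_↓_ : Pred (Z2^ (suc k)) ℓ → Z2^ k → Pred (Z2^ k) ℓ
(W ↓ z) x = W (false ∷ x) ⊎ W (true ∷ (z ⊕ x))

spannedOrSeparated-lift : {W : Pred (Z2^ (suc k)) ℓ} {z : Z2^ k} → W (true ∷ z) →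
  ∀ {y} → SpannedOrSeparated (W ↓ z) y → SpannedOrSeparated W (false ∷ y)
spannedOrSeparated-lift {W = W} {z} Wz (inj₁ Sy) = inj₁ (Span-map (λ _ _ → refl) lift Sy)
  where
  lift : ∀ {x} → (W ↓ z) x → Span W (false ∷ x)
  lift     (inj₁ W₀x)  = Span-∈ W₀x
  lift {x} (inj₂ W₁zx) =
    subst (Span W) (cong (false ∷_) (⊕-cancelˡ z x)) (Span-⊕ (Span-∈ Wz) (Span-∈ W₁zx))
spannedOrSeparated-lift {W = W} {z} Wz (inj₂ (g , g⊥W↓z , gy)) = inj₂ (g · z ∷ g , f⊥W , gy)
  where
  f⊥W : ∀ {w} → W w → (g · z ∷ g) · w ≡ false
  f⊥W {false ∷ x} W₀x = g⊥W↓z (inj₁ W₀x)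
  f⊥W {true ∷ x}  W₁x = trans (sym (·-distrib-⊕ g z x))
                              (g⊥W↓z (inj₂ (subst (λ t → W (true ∷ t)) (sym (⊕-cancelˡ z x)) W₁x)))

-- Induction on k: if W has a vector true ∷ z, pass to the quotient W ↓ z; otherwise drop the
-- first coordinate. The search uses that Z2^ k and Subset k are both Vec Bool k.
spannedOrSeparated : {W : Pred (Z2^ k) ℓ} → Decidable W → ∀ u → SpannedOrSeparated W u
spannedOrSeparated {k = zero} W? [] = inj₁ Span-𝟎
spannedOrSeparated {k = suc k} {W = W} W? (b ∷ y) with anySubset? (W? ∘ (true ∷_))
... | no ∄W₁ = spannedOrSeparated-tail (λ x W₁x → ∄W₁ (x , W₁x)) b (spannedOrSeparated (W? ∘ (false ∷_)) y)
... | yes (z , Wz) = reduce b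
  where
  below : ∀ y → SpannedOrSeparated W (false ∷ y)
  below y = spannedOrSeparated-lift Wz (spannedOrSeparated (λ x → W? (false ∷ x) ⊎-dec W? (true ∷ (z ⊕ x))) y)
  reduce : ∀ b → SpannedOrSeparated W (b ∷ y)
  reduce false = below y
  reduce true  = subst (SpannedOrSeparated W) (cong (true ∷_) (⊕-cancelˡ z y))
                       (spannedOrSeparated-shift Wz (below (z ⊕ y)))

odd : ℕ → Bool
odd zero    = false
odd (suc n) = not (odd n)

odd-+ : ∀ m n → odd (m + n) ≡ odd m xor odd n
odd-+ zero    n = refl
odd-+ (suc m) n = trans (cong not (odd-+ m n)) (not-distribˡ-xor (odd m) (odd n))

odd-1+2* : ∀ r → odd (suc (2 * r)) ≡ true
odd-1+2* r = cong not (begin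
  odd (r + (r + 0))  ≡⟨ cong (λ s → odd (r + s)) (+-identityʳ r) ⟩
  odd (r + r)        ≡⟨ odd-+ r r ⟩
  odd r xor odd r    ≡⟨ xor-same (odd r) ⟩
  false              ∎)
  where open ≡-Reasoning

odd⇒≡1+2* : ∀ n → odd n ≡ true → ∃ λ r → n ≡ suc (2 * r)
odd⇒≡1+2* (suc zero)    _ = 0 , refl
odd⇒≡1+2* (suc (suc n)) oddn with odd⇒≡1+2* n (trans (sym (not-involutive (odd n))) oddn)
... | r , refl = suc r , cong suc (sym (*-suc 2 r))

OddZeroSum : Pred (Z2^ k) ℓ → Set ℓ
OddZeroSum X = ∃ λ L → All X L × odd (length L) ≡ true × sum L ≡ 𝟎

OddZeroSum-map : {X : Pred (Z2^ m) ℓ} {φ : Z2^ k → Z2^ m} → Additive φ → OddZeroSum (X ∘ φ) → OddZeroSum X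
OddZeroSum-map {φ = φ} φ-⊕ (L , Xs , oddL , ΣL≡𝟎) =
  map φ L , map⁺ Xs , trans (cong odd (length-map φ L)) oddL ,
  trans (sum-map φ-⊕ L) (trans (cong φ ΣL≡𝟎) (additive⇒𝟎 φ-⊕))

Lifted : Pred (Z2^ k) ℓ → Pred (Z2^ (suc k)) ℓ
Lifted X (b ∷ x) = b ≡ true × X x

Lifted? : {X : Pred (Z2^ k) ℓ} → Decidable X → Decidable (Lifted X)
Lifted? X? (b ∷ x) = (b ≟ᵇ true) ×-dec X? x

sum-Lifted : {X : Pred (Z2^ k) ℓ} (L : List (Z2^ (suc k))) → All (Lifted X) L →
             ∃ λ L′ → All X L′ × sum L ≡ odd (length L′) ∷ sum L′
sum-Lifted []               []               = [] , [] , refl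
sum-Lifted ((true ∷ x) ∷ L) ((refl , Xx) ∷ Xs) with sum-Lifted L Xs
... | L′ , Xs′ , ΣL≡ = x ∷ L′ , Xx ∷ Xs′ , cong ((true ∷ x) ⊕_) ΣL≡

-- Duality for {true ∷ x | x ∈ X} and true ∷ 𝟎: a representation of true ∷ 𝟎 is an odd zero sum
-- in X, and a separator true ∷ f takes the value 1 on X.
oddZeroSum⊎offHyperplane : {X : Pred (Z2^ k) ℓ} → Decidable X →
  OddZeroSum X ⊎ ∃ λ f → ∀ {x} → X x → f · x ≡ true
oddZeroSum⊎offHyperplane X? with spannedOrSeparated (Lifted? X?) (true ∷ 𝟎)
... | inj₁ (L , Xs , ΣL≡) with sum-Lifted L Xs
...   | L′ , Xs′ , ΣL≡′ with ∷-injective (trans (sym ΣL≡′) ΣL≡)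
...     | oddL′ , ΣL′≡𝟎 = inj₁ (L′ , Xs′ , oddL′ , ΣL′≡𝟎)
oddZeroSum⊎offHyperplane X? | inj₂ (false ∷ f , _ , f𝟎) = contradiction (trans (sym f𝟎) (·-𝟎ʳ f)) λ ()
oddZeroSum⊎offHyperplane X? | inj₂ (true ∷ f , f⊥X , _) = inj₂ (f , λ Xx → not-injective (f⊥X (refl , Xx)))

record KernelEmbedding (f : Z2^ (suc k)) : Set where
  field
    ι           : Z2^ k → Z2^ (suc k)
    ι-additive  : Additive ι
    ι-injective : ∀ {x} → ι x ≡ 𝟎 → x ≡ 𝟎
    ι-kernel    : ∀ x → f · ι x ≡ false

kernelEmbedding : (f : Z2^ (suc k)) → KernelEmbedding f
kernelEmbedding (true ∷ h) = record
  { ι           = λ x → h · x ∷ x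
  ; ι-additive  = λ x y → cong (_∷ _) (·-distrib-⊕ h x y)
  ; ι-injective = ∷-injectiveʳ
  ; ι-kernel    = λ x → trans (cong (_xor h · x) (∧-identityʳ (h · x))) (xor-same (h · x))
  }
kernelEmbedding {k = zero} (false ∷ []) = record
  { ι           = λ _ → false ∷ []
  ; ι-additive  = λ _ _ → refl
  ; ι-injective = λ { {[]} _ → refl }
  ; ι-kernel    = λ _ → refl
  }
kernelEmbedding {k = suc k} (false ∷ h) = record
  { ι           = λ { (b ∷ x) → b ∷ ψ.ι x }
  ; ι-additive  = λ { (a ∷ x) (b ∷ y) → cong (_ ∷_) (ψ.ι-additive x y) }
  ; ι-injective = λ { {b ∷ x} ιx≡𝟎 →
                      cong₂ _∷_ (∷-injectiveˡ ιx≡𝟎) (ψ.ι-injective (∷-injectiveʳ ιx≡𝟎)) }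
  ; ι-kernel    = λ { (false ∷ x) → ψ.ι-kernel x ; (true ∷ x) → ψ.ι-kernel x }
  }
  where module ψ = KernelEmbedding (kernelEmbedding h)

-- Class 0 either has an odd zero sum or lies in f · x = 1; then the other c - 1 classes cover the
-- nonzero vectors of the hyperplane f · x = 0, a copy of Z2^(k - 1).
oddZeroSumClass : c < k → (C : Fin c → Pred (Z2^ k) ℓ) → (∀ j → Decidable (C j)) →
  (∀ {v} → v ≢ 𝟎 → ∃ λ j → C j v) → ∃ λ j → OddZeroSum (C j)
oddZeroSumClass {c = zero} (s≤s _) C C? cover with cover {true ∷ 𝟎} (λ ())
... | () , _
oddZeroSumClass {c = suc c} (s≤s c<k) C C? cover with oddZeroSum⊎offHyperplane (C? zero)
... | inj₁ ozs = zero , ozs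
... | inj₂ (f , f≡1) =
  Product.map suc (OddZeroSum-map ι-additive)
    (oddZeroSumClass c<k (λ j → C (suc j) ∘ ι) (λ j → C? (suc j) ∘ ι) cover′)
  where
  open KernelEmbedding (kernelEmbedding f)
  cover′ : ∀ {x} → x ≢ 𝟎 → ∃ λ j → C (suc j) (ι x)
  cover′ {x} x≢𝟎 with cover (x≢𝟎 ∘ ι-injective)
  ... | suc j , Cιx = j , Cιx
  ... | zero  , Cιx = contradiction (trans (sym (f≡1 Cιx)) (ι-kernel x)) λ ()

Circuit : (Fin n → Z2^ k) → Set
Circuit a = sumOver a ⊤ ≡ 𝟎 × (∀ T → T ⊂ ⊤ → Nonempty T → sumOver a T ≢ 𝟎)

sumOver-∅ : (a : Fin n → Z2^ k) → sumOver a ∅ ≡ 𝟎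
sumOver-∅ {n = zero}  a = refl
sumOver-∅ {n = suc n} a = sumOver-∅ (a ∘ suc)

sumOver-⁅⁆ : (a : Fin n → Z2^ k) (i : Fin n) → sumOver a ⁅ i ⁆ ≡ a i
sumOver-⁅⁆ a zero    = trans (cong (a zero ⊕_) (sumOver-∅ (a ∘ suc))) (⊕-identityʳ (a zero))
sumOver-⁅⁆ a (suc i) = sumOver-⁅⁆ (a ∘ suc) i

sumOver-⁅⁆∪⁅⁆ : (a : Fin n → Z2^ k) {i j : Fin n} → i ≢ j → sumOver a (⁅ i ⁆ ∪ ⁅ j ⁆) ≡ a i ⊕ a j
sumOver-⁅⁆∪⁅⁆ a {zero}  {zero}  i≢j = contradiction refl i≢j
sumOver-⁅⁆∪⁅⁆ a {zero}  {suc j} _   =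
  cong (a zero ⊕_) (trans (cong (sumOver (a ∘ suc)) (∪-identityˡ ⁅ j ⁆)) (sumOver-⁅⁆ (a ∘ suc) j))
sumOver-⁅⁆∪⁅⁆ a {suc i} {zero}  _   =
  trans (cong (a zero ⊕_) (trans (cong (sumOver (a ∘ suc)) (∪-identityʳ ⁅ i ⁆)) (sumOver-⁅⁆ (a ∘ suc) i)))
        (⊕-comm (a zero) (a (suc i)))
sumOver-⁅⁆∪⁅⁆ a {suc i} {suc j} i≢j = sumOver-⁅⁆∪⁅⁆ (a ∘ suc) (i≢j ∘ cong suc)

∃≢₂ : (i j : Fin (3 + n)) → ∃ λ t → t ≢ i × t ≢ j
∃≢₂ zero          zero          = suc zero       , (λ ()) , (λ ())
∃≢₂ zero          (suc zero)    = suc (suc zero) , (λ ()) , (λ ())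
∃≢₂ zero          (suc (suc j)) = suc zero       , (λ ()) , (λ ())
∃≢₂ (suc zero)    zero          = suc (suc zero) , (λ ()) , (λ ())
∃≢₂ (suc (suc i)) zero          = suc zero       , (λ ()) , (λ ())
∃≢₂ (suc i)       (suc j)       = zero           , (λ ()) , (λ ())

-- A repeated vector would give a dependent pair, which is proper as soon as n ≥ 3.
circuit-injective : {a : Fin n → Z2^ k} → odd n ≡ true → Circuit a → Injective _≡_ _≡_ a
circuit-injective {n = 1} _ _ {zero} {zero} _ = refl
circuit-injective {n = suc (suc (suc n))} {a = a} _ (_ , minimal) {i} {j} ai≡aj with i ≟ᶠ j
... | yes i≡j = i≡j
... | no  i≢j with ∃≢₂ i j
...   | t , t≢i , t≢j = contradiction pair≡𝟎 (minimal (⁅ i ⁆ ∪ ⁅ j ⁆) pair⊂⊤ (i , x∈p∪q⁺ (inj₁ (x∈⁅x⁆ i))))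
  where
  pair⊂⊤ : ⁅ i ⁆ ∪ ⁅ j ⁆ ⊂ ⊤
  pair⊂⊤ = ⊆⊤ , t , ∈⊤ , λ t∈ → [ t≢i ∘ x∈⁅y⁆⇒x≡y i , t≢j ∘ x∈⁅y⁆⇒x≡y j ]′ (x∈p∪q⁻ ⁅ i ⁆ ⁅ j ⁆ t∈)
  pair≡𝟎 : sumOver a (⁅ i ⁆ ∪ ⁅ j ⁆) ≡ 𝟎
  pair≡𝟎 = trans (sumOver-⁅⁆∪⁅⁆ a i≢j) (trans (cong (_⊕ a j) ai≡aj) (⊕-self (a j)))

circuit⇒minimalLinDep : {a : Fin n → Z2^ k} → odd n ≡ true → Circuit a → MinimalLinDep a
circuit⇒minimalLinDep oddn circuit@(Σ≡𝟎 , minimal) =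
  circuit-injective oddn circuit , Σ≡𝟎 , λ S S⊂⊤ T T⊆S → minimal T (⊆-⊂-trans T⊆S S⊂⊤)

embed : (T : Subset n) → Fin ∣ T ∣ → Fin n
embed (true ∷ T)  zero    = zero
embed (true ∷ T)  (suc i) = suc (embed T i)
embed (false ∷ T) i       = suc (embed T i)

sumOver-embed : (a : Fin n → Z2^ k) (T : Subset n) → sumOver (a ∘ embed T) ⊤ ≡ sumOver a T
sumOver-embed a []          = refl
sumOver-embed a (true ∷ T)  = cong (a zero ⊕_) (sumOver-embed (a ∘ suc) T)
sumOver-embed a (false ∷ T) = sumOver-embed (a ∘ suc) T

sumOver-∁ : (a : Fin n → Z2^ k) (T : Subset n) → sumOver a T ⊕ sumOver a (∁ T) ≡ sumOver a ⊤
sumOver-∁ a []          = ⊕-self 𝟎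
sumOver-∁ a (true ∷ T)  = trans (⊕-assoc (a zero) _ _) (cong (a zero ⊕_) (sumOver-∁ (a ∘ suc) T))
sumOver-∁ a (false ∷ T) = begin
  sumOver a′ T ⊕ (a zero ⊕ sumOver a′ (∁ T)) ≡⟨ sym (⊕-assoc (sumOver a′ T) (a zero) _) ⟩
  (sumOver a′ T ⊕ a zero) ⊕ sumOver a′ (∁ T) ≡⟨ cong (_⊕ sumOver a′ (∁ T)) (⊕-comm (sumOver a′ T) (a zero)) ⟩
  (a zero ⊕ sumOver a′ T) ⊕ sumOver a′ (∁ T) ≡⟨ ⊕-assoc (a zero) (sumOver a′ T) _ ⟩
  a zero ⊕ (sumOver a′ T ⊕ sumOver a′ (∁ T)) ≡⟨ cong (a zero ⊕_) (sumOver-∁ a′ T) ⟩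
  a zero ⊕ sumOver a′ ⊤                      ∎
  where
  open ≡-Reasoning
  a′ = a ∘ suc

∣p∣+∣∁p∣≡n : (p : Subset n) → ∣ p ∣ + ∣ ∁ p ∣ ≡ n
∣p∣+∣∁p∣≡n p = trans (cong (∣ p ∣ +_) (∣∁p∣≡n∸∣p∣ p)) (m+[n∸m]≡n (∣p∣≤n p))

p⊂⊤⇒∣p∣<n : {p : Subset n} → p ⊂ ⊤ → ∣ p ∣ < n
p⊂⊤⇒∣p∣<n {n = n} {p} p⊂⊤ = subst (∣ p ∣ <_) (∣⊤∣≡n n) (p⊂q⇒∣p∣<∣q∣ p⊂⊤)

-- Of a zero-sum part T and its complement, whichever has odd size is again a zero-sum part.
oddZeroSumPart : {a : Fin n → Z2^ k} {T : Subset n} → odd n ≡ true → sumOver a ⊤ ≡ 𝟎 →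
  T ⊂ ⊤ → Nonempty T → sumOver a T ≡ 𝟎 → ∃ λ S → S ⊂ ⊤ × odd ∣ S ∣ ≡ true × sumOver a S ≡ 𝟎
oddZeroSumPart {n = n} {a = a} {T} oddn Σ⊤≡𝟎 T⊂⊤ (x , x∈T) ΣT≡𝟎 with odd ∣ T ∣ in oddT
... | true  = T , T⊂⊤ , oddT , ΣT≡𝟎
... | false = ∁ T , (⊆⊤ , x , ∈⊤ , x∈p⇒x∉∁p x∈T) , odd∁T , Σ∁T≡𝟎
  where
  open ≡-Reasoning
  odd∁T : odd ∣ ∁ T ∣ ≡ true
  odd∁T = begin
    odd ∣ ∁ T ∣                 ≡⟨ cong (_xor odd ∣ ∁ T ∣) (sym oddT) ⟩
    odd ∣ T ∣ xor odd ∣ ∁ T ∣   ≡⟨ sym (odd-+ ∣ T ∣ ∣ ∁ T ∣) ⟩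
    odd (∣ T ∣ + ∣ ∁ T ∣)       ≡⟨ cong odd (∣p∣+∣∁p∣≡n T) ⟩
    odd n                       ≡⟨ oddn ⟩
    true                        ∎
  Σ∁T≡𝟎 : sumOver a (∁ T) ≡ 𝟎
  Σ∁T≡𝟎 = begin
    sumOver a (∁ T)                ≡⟨ sym (⊕-identityˡ _) ⟩
    𝟎 ⊕ sumOver a (∁ T)            ≡⟨ cong (_⊕ sumOver a (∁ T)) (sym ΣT≡𝟎) ⟩
    sumOver a T ⊕ sumOver a (∁ T)  ≡⟨ sumOver-∁ a T ⟩
    sumOver a ⊤                    ≡⟨ Σ⊤≡𝟎 ⟩
    𝟎                              ∎

OddSubcircuit : (Fin n → Z2^ k) → Set
OddSubcircuit {n = n} a = ∃₂ λ m (e : Fin m → Fin n) → odd m ≡ true × Circuit (a ∘ e)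

oddSubcircuit-acc : Acc _<_ n → (a : Fin n → Z2^ k) → odd n ≡ true → sumOver a ⊤ ≡ 𝟎 → OddSubcircuit a
oddSubcircuit-acc {n = n} (acc rec) a oddn Σ≡𝟎
  with anySubset? (λ T → T ⊂? ⊤ ×-dec nonempty? T ×-dec sumOver a T ≟ 𝟎)
... | no ∄T = n , id , oddn , Σ≡𝟎 , λ T T⊂⊤ T≢∅ ΣT≡𝟎 → ∄T (T , T⊂⊤ , T≢∅ , ΣT≡𝟎)
... | yes (T , T⊂⊤ , T≢∅ , ΣT≡𝟎) with oddZeroSumPart oddn Σ≡𝟎 T⊂⊤ T≢∅ ΣT≡𝟎
...   | S , S⊂⊤ , oddS , ΣS≡𝟎
  with oddSubcircuit-acc (rec (p⊂⊤⇒∣p∣<n S⊂⊤)) (a ∘ embed S) oddS (trans (sumOver-embed a S) ΣS≡𝟎)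
...     | m , e , oddm , circuit = m , embed S ∘ e , oddm , circuit

oddSubcircuit : (a : Fin n → Z2^ k) → odd n ≡ true → sumOver a ⊤ ≡ 𝟎 → OddSubcircuit a
oddSubcircuit = oddSubcircuit-acc (<-wellFounded _)

-- ρ needs a proof of v ≢ 𝟎, and without function extensionality the class of j is decidable only
-- when read off one canonical such proof.
colourOf : Coloring k c → Z2^ k → Maybe (Fin c)
colourOf ρ v with v ≟ 𝟎
... | yes _   = nothing
... | no v≢𝟎 = just (ρ v v≢𝟎)

ColourClass : Coloring k c → Fin c → Pred (Z2^ k) _
ColourClass ρ j v = colourOf ρ v ≡ just j

ColourClass? : (ρ : Coloring k c) (j : Fin c) → Decidable (ColourClass ρ j)
ColourClass? ρ j v = ≡-decᵐ _≟ᶠ_ (colourOf ρ v) (just j)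

ColourClass-covers : (ρ : Coloring k c) {v : Z2^ k} → v ≢ 𝟎 → ∃ λ j → ColourClass ρ j v
ColourClass-covers ρ {v} v≢𝟎 with v ≟ 𝟎
... | yes v≡𝟎  = contradiction v≡𝟎 v≢𝟎
... | no v≢𝟎′ = ρ v v≢𝟎′ , refl

ColourClass-sound : (ρ : Coloring k c) {j : Fin c} {v : Z2^ k} → ColourClass ρ j v →
                    Σ (v ≢ 𝟎) λ v≢𝟎 → ρ v v≢𝟎 ≡ j
ColourClass-sound ρ {v = v} ρv≡j with v ≟ 𝟎
... | no v≢𝟎 = v≢𝟎 , just-injective ρv≡j

monochromaticOddCircuit⇒¬Proper : (ρ : Coloring k c) {j : Fin c} {a : Fin n → Z2^ k} →
  odd n ≡ true → Circuit a → (∀ i → ColourClass ρ j (a i)) → ¬ Proper ρ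
monochromaticOddCircuit⇒¬Proper {n = n} ρ {j} {a} oddn circuit mono proper with odd⇒≡1+2* n oddn
... | r , refl = proper r a (proj₁ ∘ coloured) (circuit⇒minimalLinDep oddn circuit) (j , proj₂ ∘ coloured)
  where
  coloured : ∀ i → Σ (a i ≢ 𝟎) λ ai≢𝟎 → ρ (a i) ai≢𝟎 ≡ j
  coloured i = ColourClass-sound ρ (mono i)

noProperColouring : c < k → (ρ : Coloring k c) → ¬ Proper ρ
noProperColouring c<k ρ with oddZeroSumClass c<k (ColourClass ρ) (ColourClass? ρ) (ColourClass-covers ρ)
... | j , L , inClass , oddL , ΣL≡𝟎 with oddSubcircuit (List.lookup L) oddL (trans (sumOver-lookup L) ΣL≡𝟎)
...   | m , e , oddm , circuit =
  monochromaticOddCircuit⇒¬Proper ρ oddm circuit (λ i → All.lookup inClass (∈-lookup (e i)))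

leadingOne : (v : Z2^ k) → v ≢ 𝟎 → Fin k
leadingOne []          v≢𝟎 = contradiction refl v≢𝟎
leadingOne (true ∷ v)  _   = zero
leadingOne (false ∷ v) v≢𝟎 = suc (leadingOne v (v≢𝟎 ∘ cong (false ∷_)))

lookup-leadingOne : (v : Z2^ k) (v≢𝟎 : v ≢ 𝟎) → lookup v (leadingOne v v≢𝟎) ≡ true
lookup-leadingOne []          v≢𝟎 = contradiction refl v≢𝟎
lookup-leadingOne (true ∷ v)  _   = refl
lookup-leadingOne (false ∷ v) v≢𝟎 = lookup-leadingOne v _

lookup-sumOver : (a : Fin n → Z2^ k) (t : Fin k) → (∀ i → lookup (a i) t ≡ true) →
                 lookup (sumOver a ⊤) t ≡ odd n
lookup-sumOver {n = zero}  a t _    = lookup-replicate t false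
lookup-sumOver {n = suc n} a t a≡1 = begin
  lookup (a zero ⊕ sumOver a′ ⊤) t               ≡⟨ lookup-zipWith _xor_ t (a zero) _ ⟩
  lookup (a zero) t xor lookup (sumOver a′ ⊤) t  ≡⟨ cong₂ _xor_ (a≡1 zero) (lookup-sumOver a′ t (a≡1 ∘ suc)) ⟩
  not (odd n)                                    ∎
  where
  open ≡-Reasoning
  a′ = a ∘ suc

leadingOne-proper : Proper (leadingOne {k})
leadingOne-proper r a a≢𝟎 (_ , Σ≡𝟎 , _) (t , leading≡t) = contradiction (begin
  true                         ≡⟨ sym (odd-1+2* r) ⟩
  odd (suc (2 * r))            ≡⟨ sym (lookup-sumOver a t a₍t₎≡1) ⟩
  lookup (sumOver a ⊤) t       ≡⟨ cong (λ s → lookup s t) Σ≡𝟎 ⟩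
  lookup 𝟎 t                   ≡⟨ lookup-replicate t false ⟩
  false                        ∎) λ ()
  where
  open ≡-Reasoning
  a₍t₎≡1 : ∀ i → lookup (a i) t ≡ true
  a₍t₎≡1 i = subst (λ s → lookup (a i) s ≡ true) (leading≡t i) (lookup-leadingOne (a i) (a≢𝟎 i))

mainTheorem12 : (k : ℕ) → k ≥ 1 →
    (¬ Σ (Coloring k (k ∸ 1)) Proper) × Σ (Coloring k k) Proper
mainTheorem12 (suc k) _ =
  (λ (ρ , proper) → noProperColouring ≤-refl ρ proper) , leadingOne , leadingOne-proper
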